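{- If $D$ is a closed type of System $\mathcal F$ with positive quantifiers ($\forall^+$), then $D$ is a syntactical data type, i.e. $D$ is both an input type and an output type.
   Context: System $\mathcal F$: types are built from type variables (and type constants) with $\rightarrow$ and $\forall$; only types in which every quantified variable actually occurs in its scope are considered. Terms are pure $\lambda$-terms; $Fv(t)$ denotes free variables. Typing $\Gamma\vdash_{\mathcal F} t:A$ is given by the rules (ax) $\Gamma\vdash x_i:A_i$ for $x_i:A_i\in\Gamma$; ($\rightarrow_i$) from $\Gamma,x:B\vdash t:C$ infer $\Gamma\vdash\lambda xt:B\rightarrow C$; ($\rightarrow_e$) from $\Gamma\vdash u:B\rightarrow C$, $\Gamma\vdash v:B$ infer $\Gamma\vdash(u)v:C$; ($\forall_i$) from $\Gamma\vdash t:A$, $X$ not free in $\Gamma$, infer $\Gamma\vdash t:\forall XA$; ($\forall_e$) from $\Gamma\vdash t:\forall XA$ infer $\Gamma\vdash t:A[C/X]$ for any type $C$. $\mathcal F_0$ is $\mathcal F$ without ($\forall_e$). A closed type $E$ is an input type iff every $\beta$-normal $t$ with $\vdash_{\mathcal F}t:E$ satisfies $\vdash_{\mathcal F_0}t:E$. A closed type $S$ is an output type iff for every $\beta$-normal $t$, $\vdash_{\mathcal F}\lambda xt:\forall X(X\rightarrow S)$ implies $x\notin Fv(t)$. $\forall^+$ and $\forall^-$ types are defined simultaneously: a type variable is both $\forall^+$ and $\forall^-$; if $A$ is $\forall^+$ (resp. $\forall^-$) and $B$ is $\forall^-$ (resp. $\forall^+$) then $B\rightarrow A$ is $\forall^+$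 (resp. $\forall^-$); if $A$ is $\forall^+$ and $X$ is free in $A$ then $\forall XA$ is $\forall^+$. -}

module Defs where

open import Data.Nat using (ℕ; zero; suc; _<ᵇ_; _≡ᵇ_; _∸_; _<_)
open import Data.Bool using (Bool; true; false; if_then_else_)
open import Data.List using (List; []; _∷_; map)
open import Data.Product using (_×_)
open import Relation.Nullary using (¬_)

data Ty : Set where
  var : ℕ → Ty
  con : ℕ → Ty
  _⇒_ : Ty → Ty → Ty
  all : Ty → Ty          -- ∀ X A, X is index 0 in the body

infixr 7 _⇒_

shift : ℕ → Ty → Ty
shift c (var n) = if n <ᵇ c then var n else var (suc n)
shift c (con k) = con k
shift c (A ⇒ B) = shift c A ⇒ shift c B
shift c (all A) = all (shift (suc c) A)

subst : ℕ → Ty → Ty → Ty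
subst j C (var n) = if n ≡ᵇ j then C else (if n <ᵇ j then var n else var (n ∸ 1))
subst j C (con k) = con k
subst j C (A ⇒ B) = subst j C A ⇒ subst j C B
subst j C (all A) = all (subst (suc j) (shift 0 C) A)

-- A [ C / X ] where A is the body of ∀ X A
_[_] : Ty → Ty → Ty
A [ C ] = subst 0 C A

data Occurs : ℕ → Ty → Set where
  o-var : ∀ {n} → Occurs n (var n)
  o-⇒l  : ∀ {n A B} → Occurs n A → Occurs n (A ⇒ B)
  o-⇒r  : ∀ {n A B} → Occurs n B → Occurs n (A ⇒ B)
  o-all : ∀ {n A} → Occurs (suc n) A → Occurs n (all A)

data WF : Ty → Set where
  wf-var : ∀ {n} → WF (var n)
  wf-con : ∀ {k} → WF (con k)
  wf-⇒   : ∀ {A B} → WF A → WF B → WF (A ⇒ B)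
  wf-all : ∀ {A} → Occurs 0 A → WF A → WF (all A)

ClosedTy : Ty → Set
ClosedTy A = ∀ n → ¬ Occurs n A

data Pos : Ty → Set
data Neg : Ty → Set
data Pos where
  p-var : ∀ {n} → Pos (var n)
  p-⇒   : ∀ {B A} → Neg B → Pos A → Pos (B ⇒ A)
  p-all : ∀ {A} → Pos A → Occurs 0 A → Pos (all A)
data Neg where
  n-var : ∀ {n} → Neg (var n)
  n-⇒   : ∀ {B A} → Pos B → Neg A → Neg (B ⇒ A)

data Tm : Set where
  var : ℕ → Tm
  lam : Tm → Tm
  app : Tm → Tm → Tm

data FreeIn : ℕ → Tm → Set where
  f-var  : ∀ {x} → FreeIn x (var x)
  f-lam  : ∀ {x t} → FreeIn (suc x) t → FreeIn x (lam t)
  f-appl : ∀ {x u v} → FreeIn x u → FreeIn x (app u v)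
  f-appr : ∀ {x u v} → FreeIn x v → FreeIn x (app u v)

data IsLam : Tm → Set where
  is-lam : ∀ {t} → IsLam (lam t)

data BetaNormal : Tm → Set where
  bn-var : ∀ {x} → BetaNormal (var x)
  bn-lam : ∀ {t} → BetaNormal t → BetaNormal (lam t)
  bn-app : ∀ {u v} → ¬ IsLam u → BetaNormal u → BetaNormal v →
           BetaNormal (app u v)

Ctx : Set
Ctx = List Ty

data _∋_⦂_ : Ctx → ℕ → Ty → Set where
  here  : ∀ {Γ A} → (A ∷ Γ) ∋ zero ⦂ A
  there : ∀ {Γ A B x} → Γ ∋ x ⦂ A → (B ∷ Γ) ∋ suc x ⦂ A

-- Γ ⊢[ b ] t ⦂ A : typing in F (b = true) or in F₀ (b = false, no ∀-elimination).
-- Only well-formed types are used: the types introduced by (→i) and (∀e) are WF,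
-- and (∀i) only forms ∀XA when X occurs in A.
-- "X not free in Γ" is rendered by de Bruijn shifting of Γ.
data _⊢[_]_⦂_ : Ctx → Bool → Tm → Ty → Set where
  ax   : ∀ {Γ b x A} → Γ ∋ x ⦂ A → Γ ⊢[ b ] var x ⦂ A
  →i   : ∀ {Γ b t B C} → WF B → (B ∷ Γ) ⊢[ b ] t ⦂ C → Γ ⊢[ b ] lam t ⦂ (B ⇒ C)
  →e   : ∀ {Γ b u v B C} → Γ ⊢[ b ] u ⦂ (B ⇒ C) → Γ ⊢[ b ] v ⦂ B → Γ ⊢[ b ] app u v ⦂ C
  ∀i   : ∀ {Γ b t A} → Occurs 0 A → map (shift 0) Γ ⊢[ b ] t ⦂ A → Γ ⊢[ b ] t ⦂ all A
  ∀e   : ∀ {Γ t A C} → WF C → Γ ⊢[ true ] t ⦂ all A → Γ ⊢[ true ] t ⦂ (A [ C ])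

_⊢F_⦂_ : Ctx → Tm → Ty → Set
Γ ⊢F t ⦂ A = Γ ⊢[ true ] t ⦂ A

_⊢F₀_⦂_ : Ctx → Tm → Ty → Set
Γ ⊢F₀ t ⦂ A = Γ ⊢[ false ] t ⦂ A

InputType : Ty → Set
InputType E = ClosedTy E × (∀ t → BetaNormal t → [] ⊢F t ⦂ E → [] ⊢F₀ t ⦂ E)

-- ∀X (X → S): S is closed, so it needs no shifting under the binder
OutputType : Ty → Set
OutputType S = ClosedTy S ×
  (∀ t → BetaNormal t → [] ⊢F lam t ⦂ all (var 0 ⇒ S) → ¬ FreeIn 0 t)

SyntacticalDataType : Ty → Set
SyntacticalDataType D = InputType D × OutputType D

module Submission where

-- Both halves are proved by one induction on β-normal forms, in a context Γ
-- whose types are all ∀⁻ (types with no ∀ along their result spine).  There: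
--   * a typing of a neutral term x u₁ … uₙ is a spine of (ax)/(→e): (∀e)
--     needs a ∀ at the root of a spine type, and (∀i) would need the fresh
--     type variable to occur in a type taken from the shifted context;
--   * a typing of an abstraction λu is an arrow typing of u under
--     (∀i)-generalisations, each (∀e) being absorbed by type substitution.
-- For a ∀⁺ goal these inversions recurse into ∀⁺ goals in ∀⁻ contexts; this
-- yields an F₀-derivation (input part) and, tracking a variable x whose type
-- is a type variable X absent from the goal, shows x does not occur (output).

open import Defs
open import Data.Nat using (ℕ; zero; suc; _<ᵇ_; _≡ᵇ_; _<_; _≤_; z≤n; s≤s; _≟_; _<?_)
open import Data.Nat.Properties
  using (<-cmp; <-≤-trans; ≤-trans; <⇒≤; <⇒≢; n≮n; ≮⇒≥; m≤n⇒m≤1+n)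
open import Data.Bool using (true; false)
open import Data.List using ([]; _∷_; map)
open import Data.List.Properties using (map-∘; map-cong; map-id)
open import Data.Product using (_×_; _,_; Σ)
open import Data.Sum using (_⊎_; inj₁; inj₂)
open import Data.Empty using (⊥-elim)
open import Relation.Nullary using (¬_; yes; no)
open import Relation.Binary.Definitions using (tri<; tri≈; tri>)
open import Relation.Binary.PropositionalEquality
  using (_≡_; refl; sym; trans; cong; cong₂; _≢_) renaming (subst to transport)

<ᵇ-true : ∀ {m n} → m < n → (m <ᵇ n) ≡ true
<ᵇ-true {zero}  {suc n} _         = refl
<ᵇ-true {suc m} {suc n} (s≤s m<n) = <ᵇ-true m<n

<ᵇ-false : ∀ {m n} → n ≤ m → (m <ᵇ n) ≡ false
<ᵇ-false {m}     {zero}  _         = refl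
<ᵇ-false {suc m} {suc n} (s≤s n≤m) = <ᵇ-false n≤m

≡ᵇ-true : ∀ n → (n ≡ᵇ n) ≡ true
≡ᵇ-true zero    = refl
≡ᵇ-true (suc n) = ≡ᵇ-true n

≡ᵇ-false : ∀ {m n} → m ≢ n → (m ≡ᵇ n) ≡ false
≡ᵇ-false {zero}  {zero}  m≢n = ⊥-elim (m≢n refl)
≡ᵇ-false {zero}  {suc n} _   = refl
≡ᵇ-false {suc m} {zero}  _   = refl
≡ᵇ-false {suc m} {suc n} m≢n = ≡ᵇ-false (λ m≡n → m≢n (cong suc m≡n))

shift-var< : ∀ {c n} → n < c → shift c (var n) ≡ var n
shift-var< n<c rewrite <ᵇ-true n<c = refl

shift-var≥ : ∀ {c n} → c ≤ n → shift c (var n) ≡ var (suc n)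
shift-var≥ c≤n rewrite <ᵇ-false c≤n = refl

subst-var< : ∀ {j C n} → n < j → subst j C (var n) ≡ var n
subst-var< n<j rewrite ≡ᵇ-false (<⇒≢ n<j) | <ᵇ-true n<j = refl

subst-var≡ : ∀ {j C} → subst j C (var j) ≡ C
subst-var≡ {j} rewrite ≡ᵇ-true j = refl

subst-var> : ∀ {j C m} → j ≤ m → subst j C (var (suc m)) ≡ var m
subst-var> {j} {C} {m} j≤m
  rewrite ≡ᵇ-false (λ (e : suc m ≡ j) → <⇒≢ (s≤s j≤m) (sym e))
        | <ᵇ-false (m≤n⇒m≤1+n j≤m) = refl

shift-comm : ∀ {c d} → c ≤ d → ∀ A → shift (suc d) (shift c A) ≡ shift c (shift d A)
shift-comm {c} {d} c≤d (var n) with n <? d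
... | no n≮d
  rewrite shift-var≥ {d} (≮⇒≥ n≮d) | shift-var≥ {c} (≤-trans c≤d (≮⇒≥ n≮d))
        | shift-var≥ {c} (m≤n⇒m≤1+n (≤-trans c≤d (≮⇒≥ n≮d)))
        | shift-var≥ {suc d} (s≤s (≮⇒≥ n≮d)) = refl
... | yes n<d with n <? c
...   | yes n<c
  rewrite shift-var< n<d | shift-var< n<c | shift-var< {suc d} (m≤n⇒m≤1+n n<d) = refl
...   | no n≮c
  rewrite shift-var< n<d | shift-var≥ {c} (≮⇒≥ n≮c) | shift-var< {suc d} (s≤s n<d) = refl
shift-comm c≤d (con k) = refl
shift-comm c≤d (A ⇒ B) = cong₂ _⇒_ (shift-comm c≤d A) (shift-comm c≤d B)
shift-comm c≤d (all A) = cong all (shift-comm (s≤s c≤d) A)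

subst-shift-comm : ∀ {c j} → c ≤ j → ∀ C B →
  subst (suc j) (shift c C) (shift c B) ≡ shift c (subst j C B)
subst-shift-comm {c} {j} c≤j C (var n) with <-cmp n j
... | tri≈ _ refl _ rewrite shift-var≥ {c} c≤j | subst-var≡ {n} {C} = subst-var≡ {suc n}
... | tri< n<j _ _ with n <? c
...   | yes n<c
  rewrite shift-var< n<c | subst-var< {suc j} {shift c C} (m≤n⇒m≤1+n n<j)
        | subst-var< {j} {C} n<j | shift-var< n<c = refl
...   | no n≮c
  rewrite shift-var≥ {c} (≮⇒≥ n≮c) | subst-var< {suc j} {shift c C} (s≤s n<j)
        | subst-var< {j} {C} n<j | shift-var≥ {c} (≮⇒≥ n≮c) = refl
subst-shift-comm {c} {j} c≤j C (var (suc m)) | tri> _ _ (s≤s j≤m)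
  rewrite shift-var≥ {c} (≤-trans c≤j (m≤n⇒m≤1+n j≤m))
        | subst-var> {suc j} {shift c C} (s≤s j≤m) | subst-var> {j} {C} j≤m
        | shift-var≥ {c} (≤-trans c≤j j≤m) = refl
subst-shift-comm c≤j C (con k) = refl
subst-shift-comm c≤j C (A ⇒ B) = cong₂ _⇒_ (subst-shift-comm c≤j C A) (subst-shift-comm c≤j C B)
subst-shift-comm {c} {j} c≤j C (all A) = cong all (trans
  (cong (λ Z → subst (suc (suc j)) Z (shift (suc c) A)) (sym (shift-comm z≤n C)))
  (subst-shift-comm (s≤s c≤j) (shift 0 C) A))

subst-shift-cancel : ∀ c X A → subst c X (shift c A) ≡ A
subst-shift-cancel c X (var n) with n <? c
... | yes n<c rewrite shift-var< n<c | subst-var< {c} {X} n<c = refl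
... | no n≮c  rewrite shift-var≥ {c} (≮⇒≥ n≮c) | subst-var> {c} {X} (≮⇒≥ n≮c) = refl
subst-shift-cancel c X (con k) = refl
subst-shift-cancel c X (A ⇒ B) = cong₂ _⇒_ (subst-shift-cancel c X A) (subst-shift-cancel c X B)
subst-shift-cancel c X (all A) = cong all (subst-shift-cancel (suc c) (shift 0 X) A)

subst-subst : ∀ {i j} → i ≤ j → ∀ C C' A →
  subst j C (subst i C' A) ≡ subst i (subst j C C') (subst (suc j) (shift i C) A)
subst-subst {i} {j} i≤j C C' (var n) with <-cmp n i
... | tri< n<i _ _
  rewrite subst-var< {i} {C'} n<i | subst-var< {j} {C} (<-≤-trans n<i i≤j)
        | subst-var< {suc j} {shift i C} (<-≤-trans n<i (m≤n⇒m≤1+n i≤j))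
        | subst-var< {i} {subst j C C'} n<i = refl
... | tri≈ _ refl _
  rewrite subst-var≡ {n} {C'} | subst-var< {suc j} {shift n C} (s≤s i≤j)
        | subst-var≡ {n} {subst j C C'} = refl
subst-subst {i} {j} i≤j C C' (var (suc m)) | tri> _ _ (s≤s i≤m) with <-cmp m j
... | tri< m<j _ _
  rewrite subst-var> {i} {C'} i≤m | subst-var< {j} {C} m<j
        | subst-var< {suc j} {shift i C} (s≤s m<j) | subst-var> {i} {subst j C C'} i≤m = refl
... | tri≈ _ refl _
  rewrite subst-var> {i} {C'} i≤m | subst-var≡ {m} {C} | subst-var≡ {suc m} {shift i C} =
    sym (subst-shift-cancel i (subst m C C') C)
subst-subst {i} {j} i≤j C C' (var (suc (suc k))) | tri> _ _ (s≤s i≤m) | tri> _ _ (s≤s j≤k)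
  rewrite subst-var> {i} {C'} i≤m | subst-var> {j} {C} j≤k
        | subst-var> {suc j} {shift i C} (s≤s j≤k)
        | subst-var> {i} {subst j C C'} (≤-trans i≤j j≤k) = refl
subst-subst i≤j C C' (con k) = refl
subst-subst i≤j C C' (A ⇒ B) = cong₂ _⇒_ (subst-subst i≤j C C' A) (subst-subst i≤j C C' B)
subst-subst {i} {j} i≤j C C' (all A) = cong all (trans
  (subst-subst (s≤s i≤j) (shift 0 C) (shift 0 C') A)
  (cong₂ (λ X Y → subst (suc i) X (subst (suc (suc j)) Y A))
         (subst-shift-comm z≤n C C') (shift-comm z≤n C)))

occurs-var : ∀ {m n} → Occurs m (var n) → m ≡ n
occurs-var o-var = refl

occurs-shift-below : ∀ {n c} A → Occurs n A → n < c → Occurs n (shift c A)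
occurs-shift-below (var k) o-var n<c rewrite shift-var< n<c = o-var
occurs-shift-below (A ⇒ B) (o-⇒l o) n<c = o-⇒l (occurs-shift-below A o n<c)
occurs-shift-below (A ⇒ B) (o-⇒r o) n<c = o-⇒r (occurs-shift-below B o n<c)
occurs-shift-below (all A) (o-all o) n<c = o-all (occurs-shift-below A o (s≤s n<c))

occurs-subst-below : ∀ {n j} C A → Occurs n A → n < j → Occurs n (subst j C A)
occurs-subst-below C (var k) o-var n<j rewrite subst-var< {C = C} n<j = o-var
occurs-subst-below C (A ⇒ B) (o-⇒l o) n<j = o-⇒l (occurs-subst-below C A o n<j)
occurs-subst-below C (A ⇒ B) (o-⇒r o) n<j = o-⇒r (occurs-subst-below C B o n<j)
occurs-subst-below C (all A) (o-all o) n<j = o-all (occurs-subst-below (shift 0 C) A o (s≤s n<j))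

shift-fresh : ∀ c A → ¬ Occurs c (shift c A)
shift-fresh c (var n) with n <? c
... | yes n<c rewrite shift-var< n<c = λ o → <⇒≢ n<c (sym (occurs-var o))
... | no n≮c rewrite shift-var≥ {c} (≮⇒≥ n≮c) =
  λ o → n≮n n (transport (_≤ n) (occurs-var o) (≮⇒≥ n≮c))
shift-fresh c (A ⇒ B) (o-⇒l o) = shift-fresh c A o
shift-fresh c (A ⇒ B) (o-⇒r o) = shift-fresh c B o
shift-fresh c (all A) (o-all o) = shift-fresh (suc c) A o

occurs-shift-inv : ∀ {c X} B → c ≤ X → Occurs (suc X) (shift c B) → Occurs X B
occurs-shift-inv {c} {X} (var n) c≤X with n <? c
... | yes n<c rewrite shift-var< n<c = λ o →
  ⊥-elim (n≮n X (≤-trans (<⇒≤ (transport (_< c) (sym (occurs-var o)) n<c)) c≤X))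
... | no n≮c rewrite shift-var≥ {c} (≮⇒≥ n≮c) = λ { o-var → o-var }
occurs-shift-inv (A ⇒ B) c≤X (o-⇒l o) = o-⇒l (occurs-shift-inv A c≤X o)
occurs-shift-inv (A ⇒ B) c≤X (o-⇒r o) = o-⇒r (occurs-shift-inv B c≤X o)
occurs-shift-inv (all A) c≤X (o-all o) = o-all (occurs-shift-inv A (s≤s c≤X) o)

wf-shift : ∀ c {A} → WF A → WF (shift c A)
wf-shift c {var n} wf-var with n <ᵇ c
... | true  = wf-var
... | false = wf-var
wf-shift c wf-con = wf-con
wf-shift c (wf-⇒ wA wB) = wf-⇒ (wf-shift c wA) (wf-shift c wB)
wf-shift c {all A} (wf-all o wA) = wf-all (occurs-shift-below A o (s≤s z≤n)) (wf-shift (suc c) wA)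

wf-subst : ∀ j {C A} → WF C → WF A → WF (subst j C A)
wf-subst j {C} {var n} wC wf-var with n ≡ᵇ j | n <ᵇ j
... | true  | _     = wC
... | false | true  = wf-var
... | false | false = wf-var
wf-subst j wC wf-con = wf-con
wf-subst j wC (wf-⇒ wA wB) = wf-⇒ (wf-subst j wC wA) (wf-subst j wC wB)
wf-subst j {C} {all A} wC (wf-all o wA) =
  wf-all (occurs-subst-below (shift 0 C) A o (s≤s z≤n)) (wf-subst (suc j) (wf-shift 0 wC) wA)

pos-shift : ∀ c {A} → Pos A → Pos (shift c A)
neg-shift : ∀ c {A} → Neg A → Neg (shift c A)
pos-shift c {var n} p-var with n <ᵇ c
... | true  = p-var
... | false = p-var
pos-shift c (p-⇒ nB pA) = p-⇒ (neg-shift c nB) (pos-shift c pA)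
pos-shift c {all A} (p-all pA o) = p-all (pos-shift (suc c) pA) (occurs-shift-below A o (s≤s z≤n))
neg-shift c {var n} n-var with n <ᵇ c
... | true  = n-var
... | false = n-var
neg-shift c (n-⇒ pB nA) = n-⇒ (pos-shift c pB) (neg-shift c nA)

∋-map : ∀ {Γ x A} (f : Ty → Ty) → Γ ∋ x ⦂ A → map f Γ ∋ x ⦂ f A
∋-map f here      = here
∋-map f (there x) = there (∋-map f x)

∋-map⁻ : ∀ {Γ x B} (f : Ty → Ty) → map f Γ ∋ x ⦂ B → Σ Ty λ A → (Γ ∋ x ⦂ A) × (B ≡ f A)
∋-map⁻ {_ ∷ Γ} f here = _ , here , refl
∋-map⁻ {_ ∷ Γ} f (there x) with ∋-map⁻ f x
... | A , x′ , refl = A , there x′ , refl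

∋-functional : ∀ {Γ x A B} → Γ ∋ x ⦂ A → Γ ∋ x ⦂ B → A ≡ B
∋-functional here      here      = refl
∋-functional (there x) (there y) = ∋-functional x y

map-subst-shift : ∀ j C Γ →
  map (subst (suc j) (shift 0 C)) (map (shift 0) Γ) ≡ map (shift 0) (map (subst j C) Γ)
map-subst-shift j C Γ =
  trans (sym (map-∘ Γ)) (trans (map-cong (subst-shift-comm z≤n C) Γ) (map-∘ Γ))

map-subst-shift-cancel : ∀ C Γ → map (subst 0 C) (map (shift 0) Γ) ≡ Γ
map-subst-shift-cancel C Γ =
  trans (sym (map-∘ Γ)) (trans (map-cong (subst-shift-cancel 0 C) Γ) (map-id Γ))

subst-⊢ : ∀ {Γ b t A} j C → WF C → Γ ⊢[ b ] t ⦂ A → map (subst j C) Γ ⊢[ b ] t ⦂ subst j C A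
subst-⊢ j C wC (ax x)   = ax (∋-map (subst j C) x)
subst-⊢ j C wC (→i w d) = →i (wf-subst j wC w) (subst-⊢ j C wC d)
subst-⊢ j C wC (→e d e) = →e (subst-⊢ j C wC d) (subst-⊢ j C wC e)
subst-⊢ {Γ} {b} {t} j C wC (∀i {A = A} o d) =
  ∀i (occurs-subst-below (shift 0 C) A o (s≤s z≤n))
     (transport (λ Δ → Δ ⊢[ b ] t ⦂ subst (suc j) (shift 0 C) A)
        (map-subst-shift j C Γ) (subst-⊢ (suc j) (shift 0 C) (wf-shift 0 wC) d))
subst-⊢ {Γ} {b} {t} j C wC (∀e {A = A} {C = C′} w d) =
  transport (λ T → map (subst j C) Γ ⊢[ true ] t ⦂ T) (sym (subst-subst z≤n C C′ A))
    (∀e (wf-subst j wC w) (subst-⊢ j C wC d))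

-- The shapes a typing of λu can take: an arrow type whose body types u,
-- under any number of (∀i)-generalisations.  (∀e) steps are absorbed.
data LamTy : Ctx → Tm → Ty → Set where
  arr : ∀ {Γ u B C} → WF B → (B ∷ Γ) ⊢F u ⦂ C → LamTy Γ u (B ⇒ C)
  gen : ∀ {Γ u A} → Occurs 0 A → LamTy (map (shift 0) Γ) u A → LamTy Γ u (all A)

subst-LamTy : ∀ {Γ u A} j C → WF C → LamTy Γ u A → LamTy (map (subst j C) Γ) u (subst j C A)
subst-LamTy j C wC (arr w d) = arr (wf-subst j wC w) (subst-⊢ j C wC d)
subst-LamTy {Γ} {u} j C wC (gen {A = A} o l) =
  gen (occurs-subst-below (shift 0 C) A o (s≤s z≤n))
      (transport (λ Δ → LamTy Δ u (subst (suc j) (shift 0 C) A))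
        (map-subst-shift j C Γ) (subst-LamTy (suc j) (shift 0 C) (wf-shift 0 wC) l))

-- Every F-typing of λu has one of the LamTy shapes; an (∀e) after an (∀i)
-- is eliminated by substituting into the generalised derivation.
lam-inversion : ∀ {Γ u T} → Γ ⊢F lam u ⦂ T → LamTy Γ u T
lam-inversion (→i w d) = arr w d
lam-inversion (∀i o d) = gen o (lam-inversion d)
lam-inversion {Γ} {u} (∀e {A = A} {C = C} w d) with lam-inversion d
... | gen o l = transport (λ Δ → LamTy Δ u (A [ C ]))
                  (map-subst-shift-cancel C Γ) (subst-LamTy 0 C w l)

data Neutral : Tm → Set where
  ne-var : ∀ {y} → Neutral (var y)
  ne-app : ∀ {u v} → Neutral u → Neutral (app u v)

normal-neutral : ∀ {t} → BetaNormal t → ¬ IsLam t → Neutral t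
normal-neutral bn-var             _   = ne-var
normal-neutral (bn-lam _)         ¬lam = ⊥-elim (¬lam is-lam)
normal-neutral (bn-app ¬lam nu _) _   = ne-app (normal-neutral nu ¬lam)

data Spine : Ctx → Tm → Ty → Set where
  sp-var : ∀ {Γ y T} → Γ ∋ y ⦂ T → Spine Γ (var y) T
  sp-app : ∀ {Γ u v B C} → Spine Γ u (B ⇒ C) → Γ ⊢F v ⦂ B → Spine Γ (app u v) C

AllNeg : Ctx → Set
AllNeg Γ = ∀ {x A} → Γ ∋ x ⦂ A → Neg A

allNeg-[] : AllNeg []
allNeg-[] ()

allNeg-∷ : ∀ {Γ B} → Neg B → AllNeg Γ → AllNeg (B ∷ Γ)
allNeg-∷ nB nΓ here      = nB
allNeg-∷ nB nΓ (there x) = nΓ x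

allNeg-shift : ∀ {Γ} → AllNeg Γ → AllNeg (map (shift 0) Γ)
allNeg-shift nΓ x with ∋-map⁻ (shift 0) x
... | A , x′ , refl = neg-shift 0 (nΓ x′)

spine-neg : ∀ {Γ t T} → AllNeg Γ → Spine Γ t T → Neg T
spine-neg nΓ (sp-var x) = nΓ x
spine-neg nΓ (sp-app s d) with spine-neg nΓ s
... | n-⇒ _ nC = nC

-- A spine in a shifted context cannot mention the fresh variable 0;
-- this is what rules out (∀i) on a neutral term.
spine-fresh : ∀ {Γ t A} → Spine (map (shift 0) Γ) t A → ¬ Occurs 0 A
spine-fresh (sp-var x) with ∋-map⁻ (shift 0) x
... | A , _ , refl = shift-fresh 0 A
spine-fresh (sp-app s d) o = spine-fresh s (o-⇒r o)

-- In a ∀⁻ context every typing of a neutral term is a spine: (∀e) would need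
-- a ∀-type along the spine, (∀i) would need the fresh variable in it.
neutral-inversion : ∀ {Γ t T} → AllNeg Γ → Neutral t → Γ ⊢F t ⦂ T → Spine Γ t T
neutral-inversion nΓ ne-var        (ax x)   = sp-var x
neutral-inversion nΓ (ne-app ne)   (→e d e) = sp-app (neutral-inversion nΓ ne d) e
neutral-inversion nΓ ne            (∀i o d) =
  ⊥-elim (spine-fresh (neutral-inversion (allNeg-shift nΓ) ne d) o)
neutral-inversion nΓ ne            (∀e w d) with spine-neg nΓ (neutral-inversion nΓ ne d)
... | ()

data NormalTy (Γ : Ctx) : Tm → Ty → Set where
  nf-lam : ∀ {u A} → LamTy Γ u A → NormalTy Γ (lam u) A
  nf-neu : ∀ {t A} → Spine Γ t A → NormalTy Γ t A

normal-inversion : ∀ {Γ t A} → AllNeg Γ → BetaNormal t → Γ ⊢F t ⦂ A → NormalTy Γ t A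
normal-inversion nΓ (bn-lam _) d = nf-lam (lam-inversion d)
normal-inversion nΓ bn-var     d = nf-neu (neutral-inversion nΓ ne-var d)
normal-inversion nΓ (bn-app ¬lam nu _) d =
  nf-neu (neutral-inversion nΓ (ne-app (normal-neutral nu ¬lam)) d)

-- A β-normal term of ∀⁺ type in a ∀⁻ context is F₀-typable:
-- abstractions recurse into ∀⁺ bodies under ∀⁻ hypotheses, and the
-- arguments of a spine have ∀⁺ types since the spine types are ∀⁻.
normal-F₀ : ∀ {Γ t A} → AllNeg Γ → BetaNormal t → Pos A → Γ ⊢F t ⦂ A → Γ ⊢F₀ t ⦂ A
lam-F₀    : ∀ {Γ u A} → AllNeg Γ → BetaNormal (lam u) → Pos A → LamTy Γ u A → Γ ⊢F₀ lam u ⦂ A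
spine-F₀  : ∀ {Γ t T} → AllNeg Γ → BetaNormal t → Spine Γ t T → Γ ⊢F₀ t ⦂ T

normal-F₀ nΓ nt pA d with normal-inversion nΓ nt d
... | nf-lam l = lam-F₀ nΓ nt pA l
... | nf-neu s = spine-F₀ nΓ nt s

lam-F₀ nΓ (bn-lam nu) (p-⇒ nB pC) (arr w d) = →i w (normal-F₀ (allNeg-∷ nB nΓ) nu pC d)
lam-F₀ nΓ nt (p-all pA _) (gen o l) = ∀i o (lam-F₀ (allNeg-shift nΓ) nt pA l)

spine-F₀ nΓ bn-var (sp-var x) = ax x
spine-F₀ nΓ (bn-app _ nu nv) (sp-app s d) with spine-neg nΓ s
... | n-⇒ pB _ = →e (spine-F₀ nΓ nu s) (normal-F₀ nΓ nv pB d)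

Tracked : Ctx → ℕ → ℕ → Set
Tracked Γ x X = (Γ ∋ x ⦂ var X) × (∀ {y B} → Γ ∋ y ⦂ B → y ≢ x → ¬ Occurs X B)

tracked-shift : ∀ {Γ x X} → Tracked Γ x X → Tracked (map (shift 0) Γ) x (suc X)
tracked-shift {Γ} {x} {X} (x⦂X , others) = ∋-map (shift 0) x⦂X , others′
  where
  others′ : ∀ {y B} → map (shift 0) Γ ∋ y ⦂ B → y ≢ x → ¬ Occurs (suc X) B
  others′ y y≢x o with ∋-map⁻ (shift 0) y
  ... | A , y′ , refl = others y′ y≢x (occurs-shift-inv A z≤n o)

tracked-∷ : ∀ {Γ x X B} → ¬ Occurs X B → Tracked Γ x X → Tracked (B ∷ Γ) (suc x) X
tracked-∷ {Γ} {x} {X} {B} ¬oB (x⦂X , others) = there x⦂X , others′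
  where
  others′ : ∀ {y B′} → (B ∷ Γ) ∋ y ⦂ B′ → y ≢ suc x → ¬ Occurs X B′
  others′ here      _    = ¬oB
  others′ (there y) y≢sx = others y (λ y≡x → y≢sx (cong suc y≡x))

spine-tracked : ∀ {Γ x X t T} → Tracked Γ x X → Spine Γ t T → (T ≡ var X) ⊎ ¬ Occurs X T
spine-tracked {x = x} (x⦂X , others) (sp-var {y = y} y⦂T) with y ≟ x
... | yes refl = inj₁ (∋-functional y⦂T x⦂X)
... | no y≢x   = inj₂ (others y⦂T y≢x)
spine-tracked tr (sp-app s d) with spine-tracked tr s
... | inj₂ ¬o = inj₂ (λ o → ¬o (o-⇒r o))

-- A tracked variable does not occur in a β-normal term whose ∀⁺ type avoids X:
-- an occurrence would sit in a spine or argument whose type mentions X.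
normal-unused : ∀ {Γ t A x X} → AllNeg Γ → BetaNormal t → Pos A → Γ ⊢F t ⦂ A →
  Tracked Γ x X → ¬ Occurs X A → ¬ FreeIn x t
lam-unused : ∀ {Γ u A x X} → AllNeg Γ → BetaNormal (lam u) → Pos A → LamTy Γ u A →
  Tracked Γ x X → ¬ Occurs X A → ¬ FreeIn x (lam u)
spine-unused : ∀ {Γ t T x X} → AllNeg Γ → BetaNormal t → Spine Γ t T →
  Tracked Γ x X → ¬ Occurs X T → ¬ FreeIn x t

normal-unused nΓ nt pA d tr ¬oA with normal-inversion nΓ nt d
... | nf-lam l = lam-unused nΓ nt pA l tr ¬oA
... | nf-neu s = spine-unused nΓ nt s tr ¬oA

lam-unused nΓ (bn-lam nu) (p-⇒ nB pC) (arr w d) tr ¬oA (f-lam fr) =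
  normal-unused (allNeg-∷ nB nΓ) nu pC d (tracked-∷ (λ o → ¬oA (o-⇒l o)) tr) (λ o → ¬oA (o-⇒r o)) fr
lam-unused nΓ nt (p-all pA _) (gen o l) tr ¬oA =
  lam-unused (allNeg-shift nΓ) nt pA l (tracked-shift tr) (λ o′ → ¬oA (o-all o′))

spine-unused nΓ bn-var (sp-var y⦂T) (x⦂X , _) ¬oT f-var with ∋-functional y⦂T x⦂X
... | refl = ¬oT o-var
spine-unused nΓ (bn-app _ nu nv) (sp-app s d) tr ¬oT fr
  with spine-tracked tr s | spine-neg nΓ s | fr
... | inj₂ ¬oBC | _        | f-appl fr′ = spine-unused nΓ nu s tr ¬oBC fr′
... | inj₂ ¬oBC | n-⇒ pB _ | f-appr fr′ =
  normal-unused nΓ nv pB d tr (λ o → ¬oBC (o-⇒l o)) fr′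

-- Closed ∀⁺ types are input types (take Γ = []) and output types (take
-- Γ = X, with X absent from the closed type D).
theorem2p2p4 : (D : Ty) → ClosedTy D → Pos D → SyntacticalDataType D
theorem2p2p4 D closed pD = (closed , input) , (closed , output)
  where
  input : ∀ t → BetaNormal t → [] ⊢F t ⦂ D → [] ⊢F₀ t ⦂ D
  input t nt d = normal-F₀ allNeg-[] nt pD d

  x-tracked : Tracked (var 0 ∷ []) 0 0
  x-tracked = here , λ { here 0≢0 → ⊥-elim (0≢0 refl) ; (there ()) }

  output : ∀ t → BetaNormal t → [] ⊢F lam t ⦂ all (var 0 ⇒ D) → ¬ FreeIn 0 t
  output t nt d with lam-inversion d
  ... | gen _ (arr _ d′) =
    normal-unused (allNeg-∷ n-var allNeg-[]) nt pD d′ x-tracked (closed 0)
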